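{- For each $k\in\mathbb{N}$ there is a first-order sentence $\varphi_k$ in the language of graphs (with one binary edge relation) such that for every graph $G$, $G$ has tree-depth $k$ if and only if $G\models\varphi_k$.
   Context: Graphs are finite, loop-free and undirected. The tree-depth $\mathit{td}(G)$ of a graph $G$ is defined recursively: $\mathit{td}(G)=0$ if $V(G)=\emptyset$; $\mathit{td}(G)=1+\min\{\mathit{td}(G\setminus v)\mid v\in V(G)\}$ if $G$ is nonempty and connected, where $G\setminus v$ is the subgraph induced by $V(G)\setminus\{v\}$; and otherwise $\mathit{td}(G)=\max\{\mathit{td}(H)\mid H$ a connected component of $G\}$. -}

module Defs where

open import Data.Nat using (ℕ; zero; suc; _⊔_; _⊓_)
open import Data.Bool using (Bool; true; false; _∧_; _∨_; not; if_then_else_)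
open import Data.Fin using (Fin; zero; suc; _≟_)
open import Data.List using (List; []; _∷_; filter; foldr; map; length)
open import Data.Bool.ListAction using (any; all)
open import Data.List.Base using (allFin)
open import Data.Product using (Σ; _×_)
open import Data.Empty using (⊥)
open import Relation.Nullary.Decidable using (⌊_⌋)
open import Relation.Binary.PropositionalEquality using (_≡_)

record Graph : Set where
  field
    n      : ℕ
    adj    : Fin n → Fin n → Bool
    sym    : ∀ u v → adj u v ≡ adj v u
    irrefl : ∀ v → adj v v ≡ false
open Graph public

VSet : ℕ → Set
VSet n = Fin n → Bool

members : ∀ {n} → VSet n → List (Fin n)
members S = filter (λ v → Data.Bool._≟_ (S v) true) (allFin _)

remove : ∀ {n} → VSet n → Fin n → VSet n
remove S v u = S u ∧ not ⌊ u ≟ v ⌋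

reachStep : (G : Graph) → VSet (n G) → VSet (n G) → VSet (n G)
reachStep G S R v = R v ∨ (S v ∧ any (λ u → R u ∧ (S u ∧ adj G u v)) (allFin _))

iter : ∀ {A : Set} → ℕ → (A → A) → A → A
iter zero    f a = a
iter (suc k) f a = f (iter k f a)

-- the vertex set of the connected component of v in G[S] (for v ∈ S)
component : (G : Graph) → VSet (n G) → Fin (n G) → VSet (n G)
component G S v = iter (n G) (reachStep G S) (λ u → S u ∧ ⌊ u ≟ v ⌋)

maxL : List ℕ → ℕ
maxL = foldr _⊔_ 0

minL1 : ℕ → List ℕ → ℕ
minL1 = foldr _⊓_

-- Tree-depth of the induced subgraph G[S], following the recursive
-- definition:
--   td = 0                         if S = ∅
--   td = 1 + min_{v∈S} td(G[S∖v])  if G[S] nonempty and connected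
--   td = max over components H of G[S] of td(H)   otherwise.
-- Recursion is on a fuel argument; every recursive call is on a strictly
-- smaller vertex set, so fuel = |V(G)| suffices (fuel zero is never
-- reached when starting from fuel n G).

tdF : (G : Graph) → ℕ → VSet (n G) → ℕ
tdF G zero    S = 0
tdF G (suc f) S with members S
... | []      = 0
... | v ∷ vs  =
  if all (component G S v) (v ∷ vs)
  then suc (minL1 (tdF G f (remove S v)) (map (λ u → tdF G f (remove S u)) vs))
  else maxL (map (λ u → tdF G f (component G S u)) (v ∷ vs))

td : Graph → ℕ
td G = tdF G (n G) (λ _ → true)

-- First-order logic in the language of graphs (one binary relation E,
-- plus equality).  Variables are de Bruijn indices: Formula m has
-- free variables among Fin m.

data Formula : ℕ → Set where
  E    : ∀ {m} → Fin m → Fin m → Formula m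
  _≐_  : ∀ {m} → Fin m → Fin m → Formula m
  ¬'   : ∀ {m} → Formula m → Formula m
  _∧'_ : ∀ {m} → Formula m → Formula m → Formula m
  _∨'_ : ∀ {m} → Formula m → Formula m → Formula m
  ∃'   : ∀ {m} → Formula (suc m) → Formula m
  ∀'   : ∀ {m} → Formula (suc m) → Formula m

Sentence : Set
Sentence = Formula 0

extend : ∀ {m} {A : Set} → A → (Fin m → A) → Fin (suc m) → A
extend a ρ zero    = a
extend a ρ (suc i) = ρ i

Sat : (G : Graph) → ∀ {m} → Formula m → (Fin m → Fin (n G)) → Set
Sat G (E x y)   ρ = adj G (ρ x) (ρ y) ≡ true
Sat G (x ≐ y)   ρ = ρ x ≡ ρ y
Sat G (¬' φ)    ρ = Sat G φ ρ → ⊥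
Sat G (φ ∧' ψ)  ρ = Sat G φ ρ × Sat G ψ ρ
Sat G (φ ∨' ψ)  ρ = Data.Sum._⊎_ (Sat G φ ρ) (Sat G ψ ρ)
  where import Data.Sum
Sat G (∃' φ)    ρ = Σ (Fin (n G)) λ v → Sat G φ (extend v ρ)
Sat G (∀' φ)    ρ = (v : Fin (n G)) → Sat G φ (extend v ρ)

_⊨_ : Graph → Sentence → Set
G ⊨ φ = Sat G φ (λ ())

-- Tree-depth is characterised through components: td(G) ≤ 0 iff G is empty, and td(G) ≤ j+1 iff
-- every component C of G has a vertex v with td(C − v) ≤ j.  Such a component has bounded diameter:
-- every vertex of C reaches v through a neighbour of v in its own component of C − v, whose diameter
-- is bounded by induction, giving the bound B(j+1) = 2(B(j) + 1).  So each component is the ball of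
-- radius B(j+1) around any of its vertices.  Balls of fixed radius, the fact that a ball is saturated
-- (one more step adds nothing), and balls with one vertex removed are first-order definable from
-- their centre, so unfolding the characterisation j times over definable vertex sets yields a
-- sentence for td ≤ j; then td = k is expressed by td ≤ k ∧ ¬ td ≤ k − 1.

module Submission where

open import Defs hiding (sym)
open import Data.Nat using (ℕ; zero; suc; _+_; _≤_; _<_; _≤′_; ≤′-refl; ≤′-step; z≤n; s≤s)
open import Data.Nat.Properties
  using (≤-refl; ≤-reflexive; ≤-trans; ≤-antisym; ≤-total; ≤-pred; ≤⇒≤′; ≰⇒>; <⇒≱; <-≤-trans; ≤-<-trans;
         n≤0⇒n≡0; n≤1+n; 1+n≰n; +-suc; +-identityʳ;
         ⊓-sel; ⊔-lub; m⊔n≤o⇒m≤o; m⊔n≤o⇒n≤o; m≤n⇒m⊓o≤n; m≤n⇒o⊓m≤n)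
open import Data.Bool using (Bool; true; false; T; _∧_; not)
open import Data.Bool.Properties using (T-≡; T-∧; T-∨; ¬-not; if-cong; if-cong₂) renaming (_≟_ to _≟ᵇ_)
open import Data.Bool.ListAction using (and; any; all)
open import Data.Fin using (Fin; zero; suc; _≟_)
import Data.Fin.Properties as Fin
open import Data.Fin.Subset using (∣_∣) renaming (_∈_ to _∈ₛ_)
open import Data.Fin.Subset.Properties using (∣p∣≤n; p⊂q⇒∣p∣<∣q∣)
open import Data.List using ([]; _∷_; map; allFin)
open import Data.List.Membership.Propositional using (_∈_; lose)
open import Data.List.Membership.Propositional.Properties using (∈-allFin; ∈-filter⁺; ∈-filter⁻)
open import Data.List.Properties using (filter-≐; map-cong; map-cong-local)
open import Data.List.Relation.Unary.Any using (here; there; satisfied)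
open import Data.List.Relation.Unary.Any.Properties using (any⁺; any⁻)
import Data.List.Relation.Unary.All as All
open import Data.List.Relation.Unary.All.Properties using (all⁺; all⁻)
open import Data.Vec using (tabulate)
open import Data.Vec.Properties using (lookup∘tabulate; []=⇒lookup; lookup⇒[]=)
open import Data.Product using (Σ; ∃-syntax; _×_; _,_; proj₁; proj₂)
open import Data.Sum using (_⊎_; inj₁; inj₂; [_,_]′)
open import Data.Empty using (⊥; ⊥-elim)
open import Function using (_∘_; _⇔_; mk⇔; Equivalence)
open import Relation.Nullary using (¬_; Dec; yes; no; contradiction; _→-dec_; _×-dec_)
open import Relation.Nullary.Decidable using (⌊_⌋; T?; map′; toSum)
open import Relation.Binary.PropositionalEquality
  using (_≡_; _≢_; _≗_; refl; sym; trans; cong; cong₂; subst; module ≡-Reasoning)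

open import Function.Properties.Equivalence using () renaming (sym to ⇔-sym)

open Equivalence using (to; from)
open ≡-Reasoning

module _ {A : Set} (h : A → ℕ) where

  maxL-≤⇔ : ∀ {m} xs → maxL (map h xs) ≤ m ⇔ (∀ {x} → x ∈ xs → h x ≤ m)
  maxL-≤⇔ xs = mk⇔ (bound xs) (least xs)
    where
    bound : ∀ {m} xs → maxL (map h xs) ≤ m → ∀ {x} → x ∈ xs → h x ≤ m
    bound (y ∷ ys) le (here refl) = m⊔n≤o⇒m≤o (h y) _ le
    bound (y ∷ ys) le (there x∈) = bound ys (m⊔n≤o⇒n≤o (h y) _ le) x∈
    least : ∀ {m} xs → (∀ {x} → x ∈ xs → h x ≤ m) → maxL (map h xs) ≤ m
    least []       _  = z≤n
    least (y ∷ ys) hb = ⊔-lub (hb (here refl)) (least ys (hb ∘ there))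

  minL1-≤⇔ : ∀ {m} x xs → minL1 (h x) (map h xs) ≤ m ⇔ (∃[ y ] y ∈ x ∷ xs × h y ≤ m)
  minL1-≤⇔ x xs = mk⇔ (witness xs) (λ (y , y∈ , le) → bound xs y∈ le)
    where
    witness : ∀ {m} xs → minL1 (h x) (map h xs) ≤ m → ∃[ y ] y ∈ x ∷ xs × h y ≤ m
    witness [] le = x , here refl , le
    witness (y ∷ ys) le with ⊓-sel (h y) (minL1 (h x) (map h ys))
    ... | inj₁ eq = y , there (here refl) , subst (_≤ _) eq le
    ... | inj₂ eq with witness ys (subst (_≤ _) eq le)
    ...   | z , here refl , lez = z , here refl , lez
    ...   | z , there z∈ , lez = z , there (there z∈) , lez
    bound : ∀ {m} xs {y} → y ∈ x ∷ xs → h y ≤ m → minL1 (h x) (map h xs) ≤ m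
    bound []       (here refl)          le = le
    bound (z ∷ zs) (here refl)          le = m≤n⇒o⊓m≤n (h z) (bound zs (here refl) le)
    bound (z ∷ zs) (there (here refl))  le = m≤n⇒m⊓o≤n _ le
    bound (z ∷ zs) (there (there y∈))   le = m≤n⇒o⊓m≤n (h z) (bound zs (there y∈) le)

T-injective : ∀ {a b} → (T a → T b) → (T b → T a) → a ≡ b
T-injective {false} {false} _ _ = refl
T-injective {false} {true}  _ b⇒a = ⊥-elim (b⇒a _)
T-injective {true}  {false} a⇒b _ = ⊥-elim (a⇒b _)
T-injective {true}  {true}  _ _ = refl

module _ {m : ℕ} where

  infix 4 _∈ᵥ_ _∉ᵥ_ _⊆ᵥ_

  _∈ᵥ_ : Fin m → VSet m → Set
  u ∈ᵥ S = T (S u)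

  _∉ᵥ_ : Fin m → VSet m → Set
  u ∉ᵥ S = ¬ u ∈ᵥ S

  _⊆ᵥ_ : VSet m → VSet m → Set
  S ⊆ᵥ S′ = ∀ {u} → u ∈ᵥ S → u ∈ᵥ S′

  ⊆ᵥ-antisym : ∀ {S S′} → S ⊆ᵥ S′ → S′ ⊆ᵥ S → S ≗ S′
  ⊆ᵥ-antisym S⊆S′ S′⊆S u = T-injective S⊆S′ S′⊆S

  size : VSet m → ℕ
  size S = ∣ tabulate S ∣

  private
    ∈-tabulate⇔ : ∀ {S u} → u ∈ₛ tabulate S ⇔ u ∈ᵥ S
    ∈-tabulate⇔ {S} {u} = mk⇔
      (λ u∈ → from T-≡ (trans (sym (lookup∘tabulate S u)) ([]=⇒lookup u∈)))
      (λ u∈ → lookup⇒[]= u (tabulate S) (trans (lookup∘tabulate S u) (to T-≡ u∈)))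

  size≤ : ∀ S → size S ≤ m
  size≤ S = ∣p∣≤n (tabulate S)

  size-strict : ∀ S S′ {u} → S ⊆ᵥ S′ → u ∈ᵥ S′ → u ∉ᵥ S → size S < size S′
  size-strict S S′ S⊆S′ u∈S′ u∉S = p⊂q⇒∣p∣<∣q∣
    (from ∈-tabulate⇔ ∘ S⊆S′ ∘ to ∈-tabulate⇔ , _ , from ∈-tabulate⇔ u∈S′ , u∉S ∘ to ∈-tabulate⇔)

  size-pos : ∀ S {u} → u ∈ᵥ S → 0 < size S
  size-pos S u∈S = ≤-<-trans z≤n (size-strict (λ _ → false) S (λ ()) u∈S (λ ()))

  ∈-members⇔ : ∀ S {u} → u ∈ members S ⇔ u ∈ᵥ S
  ∈-members⇔ S {u} = mk⇔
    (λ u∈ → from T-≡ (proj₂ (∈-filter⁻ (λ v → S v ≟ᵇ true) {xs = allFin m} u∈)))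
    (λ u∈ → ∈-filter⁺ (λ v → S v ≟ᵇ true) (∈-allFin u) (to T-≡ u∈))

  members-cong : ∀ {S S′} → S ≗ S′ → members S ≡ members S′
  members-cong {S} {S′} S≗S′ = filter-≐ (λ v → S v ≟ᵇ true) (λ v → S′ v ≟ᵇ true)
    ((λ {u} eq → trans (sym (S≗S′ u)) eq) , (λ {u} eq → trans (S≗S′ u) eq)) (allFin m)

  ∈-remove⇔ : ∀ S v {u} → u ∈ᵥ remove S v ⇔ (u ∈ᵥ S × u ≢ v)
  ∈-remove⇔ S v {u} with u ≟ v
  ... | yes u≡v = mk⇔ (λ u∈ → ⊥-elim (proj₂ (to T-∧ u∈))) (λ (_ , u≢v) → ⊥-elim (u≢v u≡v))
  ... | no  u≢v = mk⇔ (λ u∈ → proj₁ (to T-∧ u∈) , u≢v) (λ (u∈ , _) → from T-∧ (u∈ , _))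

  remove-⊆ : ∀ S v → remove S v ⊆ᵥ S
  remove-⊆ S v = proj₁ ∘ to (∈-remove⇔ S v)

  size-remove : ∀ S v → v ∈ᵥ S → size (remove S v) < size S
  size-remove S v v∈S = size-strict (remove S v) S (remove-⊆ S v) v∈S (λ v∈ → proj₂ (to (∈-remove⇔ S v) v∈) refl)

  remove-cong : ∀ {S S′ : VSet m} v → S ≗ S′ → remove S v ≗ remove S′ v
  remove-cong v S≗S′ u = cong (_∧ not ⌊ u ≟ v ⌋) (S≗S′ u)

  _⊆ᵥ?_ : ∀ S S′ → Dec (S ⊆ᵥ S′)
  S ⊆ᵥ? S′ = map′ (λ ⊆ {u} → ⊆ u) (λ ⊆ u → ⊆) (Fin.all? (λ u → T? (S u) →-dec T? (S′ u)))

  ⊈ᵥ-witness : ∀ {S S′} → ¬ S ⊆ᵥ S′ → ∃[ u ] u ∈ᵥ S × u ∉ᵥ S′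
  ⊈ᵥ-witness {S} {S′} S⊈S′
    with Fin.¬∀⟶∃¬ m _ (λ u → T? (S u) →-dec T? (S′ u)) (λ ⊆ → S⊈S′ (λ {u} → ⊆ u))
  ... | u , u∈⇏ with T? (S u)
  ...   | yes u∈S = u , u∈S , λ u∈S′ → u∈⇏ (λ _ → u∈S′)
  ...   | no  u∉S = contradiction (λ u∈S → contradiction u∈S u∉S) u∈⇏

  ascending-stabilises : (A : ℕ → VSet m) → (∀ i → A i ⊆ᵥ A (suc i)) →
                         ∃[ i ] i ≤ m × A (suc i) ⊆ᵥ A i
  ascending-stabilises A A⊆ = conclude (grows (suc m))
    where
    grows : ∀ i → (∃[ k ] k < i × A (suc k) ⊆ᵥ A k) ⊎ i ≤ size (A i)
    grows zero = inj₂ z≤n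
    grows (suc i) with grows i
    ... | inj₁ (k , k<i , stable) = inj₁ (k , ≤-trans k<i (n≤1+n i) , stable)
    ... | inj₂ i≤size with A (suc i) ⊆ᵥ? A i
    ...   | yes stable = inj₁ (i , ≤-refl , stable)
    ...   | no unstable with ⊈ᵥ-witness unstable
    ...     | u , u∈new , u∉old = inj₂ (≤-<-trans i≤size (size-strict (A i) (A (suc i)) (A⊆ i) u∈new u∉old))
    conclude : (∃[ k ] k < suc m × A (suc k) ⊆ᵥ A k) ⊎ suc m ≤ size (A (suc m)) →
               ∃[ i ] i ≤ m × A (suc i) ⊆ᵥ A i
    conclude (inj₁ (i , i<1+m , stable)) = i , ≤-pred i<1+m , stable
    conclude (inj₂ 1+m≤size) = contradiction (≤-trans 1+m≤size (size≤ (A (suc m)))) 1+n≰n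

module Reachability (G : Graph) where

  V : Set
  V = Fin (n G)

  Edge : V → V → Set
  Edge u w = T (adj G u w)

  Edge-sym : ∀ {u w} → Edge u w → Edge w u
  Edge-sym {u} {w} = subst T (Graph.sym G u w)

  Closed : VSet (n G) → VSet (n G) → Set
  Closed S C = ∀ {u w} → u ∈ᵥ C → w ∈ᵥ S → Edge u w → w ∈ᵥ C

  ∈-reachStep⇔ : ∀ S A {w} →
                 w ∈ᵥ reachStep G S A ⇔ (w ∈ᵥ A ⊎ (w ∈ᵥ S × ∃[ u ] u ∈ᵥ A × u ∈ᵥ S × Edge u w))
  ∈-reachStep⇔ S A {w} = mk⇔ forward backward
    where
    enters : V → Bool
    enters u = A u ∧ (S u ∧ adj G u w)
    forward : w ∈ᵥ reachStep G S A → w ∈ᵥ A ⊎ (w ∈ᵥ S × ∃[ u ] u ∈ᵥ A × u ∈ᵥ S × Edge u w)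
    forward w∈ with to (T-∨ {A w}) w∈
    ... | inj₁ w∈A = inj₁ w∈A
    ... | inj₂ w∈step with to (T-∧ {S w}) w∈step
    ...   | w∈S , entered with satisfied (any⁻ enters (allFin _) entered)
    ...     | u , u-enters with to (T-∧ {A u}) u-enters
    ...       | u∈A , u∈S∧edge = inj₂ (w∈S , u , u∈A , to (T-∧ {S u}) u∈S∧edge)
    backward : w ∈ᵥ A ⊎ (w ∈ᵥ S × ∃[ u ] u ∈ᵥ A × u ∈ᵥ S × Edge u w) → w ∈ᵥ reachStep G S A
    backward (inj₁ w∈A) = from T-∨ (inj₁ w∈A)
    backward (inj₂ (w∈S , u , u∈A , u∈S , edge)) =
      from T-∨ (inj₂ (from T-∧ (w∈S , any⁺ enters (lose (∈-allFin u) (from T-∧ (u∈A , from T-∧ (u∈S , edge)))))))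

  reachStep-mono : ∀ {S S′ A A′} → S ⊆ᵥ S′ → A ⊆ᵥ A′ → reachStep G S A ⊆ᵥ reachStep G S′ A′
  reachStep-mono {S} {S′} {A} {A′} S⊆ A⊆ w∈ with to (∈-reachStep⇔ S A) w∈
  ... | inj₁ w∈A = from (∈-reachStep⇔ S′ A′) (inj₁ (A⊆ w∈A))
  ... | inj₂ (w∈S , u , u∈A , u∈S , edge) =
    from (∈-reachStep⇔ S′ A′) (inj₂ (S⊆ w∈S , u , A⊆ u∈A , S⊆ u∈S , edge))

  reach : VSet (n G) → V → ℕ → VSet (n G)
  reach S v i = iter i (reachStep G S) (λ u → S u ∧ ⌊ u ≟ v ⌋)

  ∈-reach-zero⇔ : ∀ S v {u} → u ∈ᵥ reach S v 0 ⇔ (u ∈ᵥ S × u ≡ v)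
  ∈-reach-zero⇔ S v {u} with u ≟ v
  ... | yes u≡v = mk⇔ (λ u∈ → proj₁ (to T-∧ u∈) , u≡v) (λ (u∈S , _) → from T-∧ (u∈S , _))
  ... | no  u≢v = mk⇔ (λ u∈ → ⊥-elim (proj₂ (to (T-∧ {S u}) u∈))) (λ (_ , u≡v) → ⊥-elim (u≢v u≡v))

  reach-self : ∀ S v → v ∈ᵥ S → v ∈ᵥ reach S v 0
  reach-self S v v∈S = from (∈-reach-zero⇔ S v) (v∈S , refl)

  reach-⊆ : ∀ S v i → reach S v i ⊆ᵥ S
  reach-⊆ S v zero    u∈ = proj₁ (to (∈-reach-zero⇔ S v) u∈)
  reach-⊆ S v (suc i) u∈ with to (∈-reachStep⇔ S (reach S v i)) u∈
  ... | inj₁ u∈R         = reach-⊆ S v i u∈R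
  ... | inj₂ (u∈S , _)   = u∈S

  reach-source : ∀ S v i {u} → u ∈ᵥ reach S v i → v ∈ᵥ S
  reach-source S v zero    u∈ with to (∈-reach-zero⇔ S v) u∈
  ... | u∈S , refl = u∈S
  reach-source S v (suc i) u∈ with to (∈-reachStep⇔ S (reach S v i)) u∈
  ... | inj₁ u∈R                    = reach-source S v i u∈R
  ... | inj₂ (_ , _ , w∈R , _ , _)  = reach-source S v i w∈R

  reach-suc : ∀ S v i → reach S v i ⊆ᵥ reach S v (suc i)
  reach-suc S v i = from (∈-reachStep⇔ S (reach S v i)) ∘ inj₁

  reach-edge : ∀ S v i {u w} → u ∈ᵥ reach S v i → w ∈ᵥ S → Edge u w → w ∈ᵥ reach S v (suc i)
  reach-edge S v i {u} u∈R w∈S edge =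
    from (∈-reachStep⇔ S (reach S v i)) (inj₂ (w∈S , u , u∈R , reach-⊆ S v i u∈R , edge))

  reach-mono : ∀ S v {i j} → i ≤ j → reach S v i ⊆ᵥ reach S v j
  reach-mono S v i≤j = go (≤⇒≤′ i≤j)
    where
    go : ∀ {i j} → i ≤′ j → reach S v i ⊆ᵥ reach S v j
    go ≤′-refl                = λ u∈ → u∈
    go (≤′-step {n = j} i≤′j) = reach-suc S v j ∘ go i≤′j

  reach-monoˢ : ∀ {S S′} v i → S ⊆ᵥ S′ → reach S v i ⊆ᵥ reach S′ v i
  reach-monoˢ {S} {S′} v zero    S⊆ u∈ with to (∈-reach-zero⇔ S v) u∈
  ... | u∈S , u≡v = from (∈-reach-zero⇔ S′ v) (S⊆ u∈S , u≡v)
  reach-monoˢ          v (suc i) S⊆ = reachStep-mono S⊆ (reach-monoˢ v i S⊆)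

  reach-least : ∀ S v {C} → (v ∈ᵥ S → v ∈ᵥ C) → Closed S C → ∀ i → reach S v i ⊆ᵥ C
  reach-least S v v∈C closed zero    u∈ with to (∈-reach-zero⇔ S v) u∈
  ... | v∈S , refl = v∈C v∈S
  reach-least S v v∈C closed (suc i) w∈ with to (∈-reachStep⇔ S (reach S v i)) w∈
  ... | inj₁ w∈R                        = reach-least S v v∈C closed i w∈R
  ... | inj₂ (w∈S , _ , u∈R , _ , edge) = closed (reach-least S v v∈C closed i u∈R) w∈S edge

  reach-trans : ∀ S x z i k {y} → z ∈ᵥ reach S x i → y ∈ᵥ reach S z k → y ∈ᵥ reach S x (i + k)
  reach-trans S x z i zero    z∈ y∈ with to (∈-reach-zero⇔ S z) y∈
  ... | _ , refl rewrite +-identityʳ i = z∈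
  reach-trans S x z i (suc k) z∈ y∈ rewrite +-suc i k with to (∈-reachStep⇔ S (reach S z k)) y∈
  ... | inj₁ y∈R                        = reach-suc S x (i + k) (reach-trans S x z i k z∈ y∈R)
  ... | inj₂ (y∈S , _ , u∈R , _ , edge) = reach-edge S x (i + k) (reach-trans S x z i k z∈ u∈R) y∈S edge

  Saturated : VSet (n G) → V → ℕ → Set
  Saturated S v i = reach S v (suc i) ⊆ᵥ reach S v i

  saturated-stable : ∀ S v {i j} → Saturated S v i → i ≤ j → reach S v j ⊆ᵥ reach S v i
  saturated-stable S v {i} saturated i≤j = go (≤⇒≤′ i≤j)
    where
    go : ∀ {j} → i ≤′ j → reach S v j ⊆ᵥ reach S v i
    go ≤′-refl        = λ u∈ → u∈
    go (≤′-step i≤′j) = saturated ∘ reachStep-mono (λ u∈ → u∈) (go i≤′j)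

  reach-saturates : ∀ S v → Saturated S v (n G)
  reach-saturates S v with ascending-stabilises (reach S v) (reach-suc S v)
  ... | i , i≤n , saturated =
    reach-mono S v i≤n ∘ saturated-stable S v saturated (≤-trans i≤n (n≤1+n (n G)))

  reach-⊆-component : ∀ S v i → reach S v i ⊆ᵥ component G S v
  reach-⊆-component S v i with ≤-total i (n G)
  ... | inj₁ i≤n = reach-mono S v i≤n
  ... | inj₂ n≤i = saturated-stable S v (reach-saturates S v) n≤i

  saturated⇒component-⊆ : ∀ S v {i} → Saturated S v i → component G S v ⊆ᵥ reach S v i
  saturated⇒component-⊆ S v {i} saturated with ≤-total (n G) i
  ... | inj₁ n≤i = reach-mono S v n≤i
  ... | inj₂ i≤n = saturated-stable S v saturated i≤n

  component-⊆ : ∀ S v → component G S v ⊆ᵥ S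
  component-⊆ S v = reach-⊆ S v (n G)

  component-self : ∀ S v → v ∈ᵥ S → v ∈ᵥ component G S v
  component-self S v = reach-⊆-component S v 0 ∘ reach-self S v

  component-closed : ∀ S v → Closed S (component G S v)
  component-closed S v u∈ w∈S edge = reach-saturates S v (reach-edge S v (n G) u∈ w∈S edge)

  component-least : ∀ S v {C} → (v ∈ᵥ S → v ∈ᵥ C) → Closed S C → component G S v ⊆ᵥ C
  component-least S v v∈C closed = reach-least S v v∈C closed (n G)

  component-monoˢ : ∀ {S S′} v → S ⊆ᵥ S′ → component G S v ⊆ᵥ component G S′ v
  component-monoˢ v = reach-monoˢ v (n G)

  component-cong : ∀ {S S′} v → S ≗ S′ → component G S v ≗ component G S′ v
  component-cong v S≗S′ = ⊆ᵥ-antisym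
    (component-monoˢ v (λ {u} → subst T (S≗S′ u)))
    (component-monoˢ v (λ {u} → subst T (sym (S≗S′ u))))

  component-⊆-of : ∀ S v {u} → u ∈ᵥ component G S v → component G S u ⊆ᵥ component G S v
  component-⊆-of S v u∈ = component-least S _ (λ _ → u∈) (component-closed S v)

  component-sym : ∀ S v {u} → u ∈ᵥ component G S v → v ∈ᵥ component G S u
  component-sym S v {u} = component-least S v {λ w → component G S w v} (component-self S v) closed
    where
    closed : Closed S (λ w → component G S w v)
    closed {w} {w′} v∈ w′∈S edge =
      component-⊆-of S w′
        (component-closed S w′ (component-self S w′ w′∈S) (reach-source S w (n G) v∈) (Edge-sym edge))
        v∈

  component-≗ : ∀ S v {u} → u ∈ᵥ component G S v → component G S u ≗ component G S v
  component-≗ S v u∈ = ⊆ᵥ-antisym (component-⊆-of S v u∈) (component-⊆-of S _ (component-sym S v u∈))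

  Connected : VSet (n G) → Set
  Connected S = ∀ {x y} → x ∈ᵥ S → y ∈ᵥ S → y ∈ᵥ component G S x

  component-connected : ∀ S v → Connected (component G S v)
  component-connected S v {x} x∈ y∈ =
    component-least S x {component G C x} (component-self C x ∘ λ _ → x∈) closed
      (subst T (sym (component-≗ S v x∈ _)) y∈)
    where
    C = component G S v
    closed : Closed S (component G C x)
    closed u∈ w∈S edge =
      component-closed C x u∈ (component-closed S v (component-⊆ C x u∈) w∈S edge) edge

  size-component< : ∀ S {v y} → v ∈ᵥ S → y ∈ᵥ S → y ∉ᵥ component G S v →
                    ∀ u → size (component G S u) < size S
  size-component< S {v} v∈S y∈S y∉ u with T? (component G S u v)
  ... | yes v∈ = size-strict (component G S u) S (component-⊆ S u) y∈S
                   (y∉ ∘ component-⊆-of S v (component-sym S u v∈))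
  ... | no  v∉ = size-strict (component G S u) S (component-⊆ S u) v∈S v∉

  neighbour-of-removed : ∀ S {v w} → Connected S → v ∈ᵥ S → w ∈ᵥ S → w ≢ v →
                         ∃[ a ] a ∈ᵥ component G (remove S v) w × Edge a v
  neighbour-of-removed S {v} {w} connected v∈S w∈S w≢v
    with Fin.any? (λ a → T? (component G (remove S v) w a) ×-dec T? (adj G a v))
  ... | yes found = found
  ... | no  none  = ⊥-elim (proj₂ (to (∈-remove⇔ S v) (component-⊆ (remove S v) w v∈K)) refl)
    where
    K = component G (remove S v) w
    closed : Closed S K
    closed {u} {t} u∈K t∈S edge with t ≟ v
    ... | yes refl = ⊥-elim (none (u , u∈K , edge))
    ... | no  t≢v  = component-closed (remove S v) w u∈K (from (∈-remove⇔ S v) (t∈S , t≢v)) edge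
    v∈K : v ∈ᵥ K
    v∈K = component-least S w (λ _ → component-self (remove S v) w (from (∈-remove⇔ S v) (w∈S , w≢v))) closed
            (connected w∈S v∈S)

module TreeDepth (G : Graph) where
  open Reachability G

  all-component⇔ : ∀ S v → T (all (component G S v) (members S)) ⇔ S ⊆ᵥ component G S v
  all-component⇔ S v = mk⇔
    (λ all-in {u} u∈ → All.lookup (all⁺ (component G S v) _ all-in) (from (∈-members⇔ S) u∈))
    (λ S⊆ → all⁻ (component G S v) (All.tabulate (λ u∈ → S⊆ (to (∈-members⇔ S) u∈))))

  ∈-members≡⇔ : ∀ {S : VSet (n G)} {l} → members S ≡ l → ∀ {u} → u ∈ l ⇔ u ∈ᵥ S
  ∈-members≡⇔ {S} refl = ∈-members⇔ S

  members≡[]⇒empty : ∀ {S : VSet (n G)} {u} → members S ≡ [] → u ∉ᵥ S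
  members≡[]⇒empty eq u∈S with from (∈-members≡⇔ eq) u∈S
  ... | ()

  tdF-empty : ∀ f {S} → (∀ {u} → u ∉ᵥ S) → tdF G f S ≡ 0
  tdF-empty zero    empty = refl
  tdF-empty (suc f) {S} empty with members S in eq
  ... | []    = refl
  ... | v ∷ _ = contradiction (to (∈-members≡⇔ eq) (here refl)) empty

  tdF-connected : ∀ f {S v vs} → members S ≡ v ∷ vs → S ⊆ᵥ component G S v →
                  tdF G (suc f) S ≡ suc (minL1 (tdF G f (remove S v)) (map (λ u → tdF G f (remove S u)) vs))
  tdF-connected f {S} {v} eq S⊆ rewrite eq
    | to T-≡ (subst (T ∘ all (component G S v)) eq (from (all-component⇔ S v) S⊆)) = refl

  tdF-disconnected : ∀ f {S v vs} → members S ≡ v ∷ vs → ¬ S ⊆ᵥ component G S v →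
                     tdF G (suc f) S ≡ maxL (map (λ u → tdF G f (component G S u)) (v ∷ vs))
  tdF-disconnected f {S} {v} eq S⊈ rewrite eq
    | ¬-not (S⊈ ∘ to (all-component⇔ S v) ∘ subst (T ∘ all (component G S v)) (sym eq) ∘ from T-≡) = refl

  tdF-cong : ∀ f {S S′} → S ≗ S′ → tdF G f S ≡ tdF G f S′
  tdF-cong zero    _ = refl
  tdF-cong (suc f) {S} {S′} S≗S′ with members S | members S′ | members-cong S≗S′
  ... | []     | _ | refl = refl
  ... | v ∷ vs | _ | refl = trans
    (if-cong (cong and (map-cong (component-cong v S≗S′) (v ∷ vs))))
    (if-cong₂ _
      (cong suc (cong₂ minL1 (tdF-cong f (remove-cong v S≗S′))
                             (map-cong (λ u → tdF-cong f (remove-cong u S≗S′)) vs)))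
      (cong maxL (map-cong (λ u → tdF-cong f (component-cong u S≗S′)) (v ∷ vs))))

  tdF-fuel : ∀ f f′ S → size S ≤ f → size S ≤ f′ → tdF G f S ≡ tdF G f′ S
  tdF-fuel zero    zero     S _    _    = refl
  tdF-fuel zero    (suc f′) S size≤ _   = sym (tdF-empty (suc f′) (λ u∈ → <⇒≱ (size-pos S u∈) size≤))
  tdF-fuel (suc f) zero     S _    size≤ = tdF-empty (suc f) (λ u∈ → <⇒≱ (size-pos S u∈) size≤)
  tdF-fuel (suc f) (suc f′) S size≤ size≤′ = by-members (members S) refl
    where
    smaller : ∀ {S′} → size S′ < size S → tdF G f S′ ≡ tdF G f′ S′
    smaller {S′} S′<S =
      tdF-fuel f f′ S′ (≤-pred (<-≤-trans S′<S size≤)) (≤-pred (<-≤-trans S′<S size≤′))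
    by-members : ∀ l → members S ≡ l → tdF G (suc f) S ≡ tdF G (suc f′) S
    by-members []       eq =
      trans (tdF-empty (suc f) (members≡[]⇒empty eq)) (sym (tdF-empty (suc f′) (members≡[]⇒empty eq)))
    by-members (v ∷ vs) eq with S ⊆ᵥ? component G S v
    ... | yes S⊆ = begin
      tdF G (suc f) S                                                      ≡⟨ tdF-connected f eq S⊆ ⟩
      suc (minL1 (tdF G f (remove S v)) (map (λ u → tdF G f (remove S u)) vs))
        ≡⟨ cong suc (cong₂ minL1 (removal (here refl)) (map-cong-local (All.tabulate (removal ∘ there)))) ⟩
      suc (minL1 (tdF G f′ (remove S v)) (map (λ u → tdF G f′ (remove S u)) vs))
                                                                           ≡⟨ tdF-connected f′ eq S⊆ ⟨
      tdF G (suc f′) S                                                     ∎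
      where
      removal : ∀ {u} → u ∈ v ∷ vs → tdF G f (remove S u) ≡ tdF G f′ (remove S u)
      removal u∈ = smaller (size-remove S _ (to (∈-members≡⇔ eq) u∈))
    ... | no S⊈ with ⊈ᵥ-witness S⊈
    ...   | y , y∈S , y∉ = begin
      tdF G (suc f) S                                               ≡⟨ tdF-disconnected f eq S⊈ ⟩
      maxL (map (λ u → tdF G f (component G S u)) (v ∷ vs))
        ≡⟨ cong maxL (map-cong (λ u → smaller (size-component< S v∈S y∈S y∉ u)) (v ∷ vs)) ⟩
      maxL (map (λ u → tdF G f′ (component G S u)) (v ∷ vs))      ≡⟨ tdF-disconnected f′ eq S⊈ ⟨
      tdF G (suc f′) S                                              ∎
      where
      v∈S : v ∈ᵥ S
      v∈S = to (∈-members≡⇔ eq) (here refl)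

  td[_] : VSet (n G) → ℕ
  td[ S ] = tdF G (n G) S

  td-cong : ∀ {S S′} → S ≗ S′ → td[ S ] ≡ td[ S′ ]
  td-cong = tdF-cong (n G)

  td-unfold : ∀ S → td[ S ] ≡ tdF G (suc (n G)) S
  td-unfold S = tdF-fuel (n G) (suc (n G)) S (size≤ S) (≤-trans (size≤ S) (n≤1+n (n G)))

  td-connected : ∀ S {v} → v ∈ᵥ S → Connected S →
                 (∃[ w ] w ∈ᵥ S × td[ S ] ≡ suc td[ remove S w ]) ×
                 (∀ {u} → u ∈ᵥ S → td[ S ] ≤ suc td[ remove S u ])
  td-connected S {v} v∈S connected rewrite td-unfold S = by-members (members S) refl
    where
    by-members : ∀ l → members S ≡ l →
                 (∃[ w ] w ∈ᵥ S × tdF G (suc (n G)) S ≡ suc td[ remove S w ]) ×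
                 (∀ {u} → u ∈ᵥ S → tdF G (suc (n G)) S ≤ suc td[ remove S u ])
    by-members []       eq = contradiction v∈S (members≡[]⇒empty eq)
    by-members (u ∷ us) eq rewrite tdF-connected (n G) eq (connected (to (∈-members≡⇔ eq) (here refl))) =
      attained , s≤s ∘ lower-bound
      where
      h : Fin (n G) → ℕ
      h w = td[ remove S w ]
      u∈S : u ∈ᵥ S
      u∈S = to (∈-members≡⇔ eq) (here refl)
      lower-bound : ∀ {w} → w ∈ᵥ S → minL1 (h u) (map h us) ≤ h w
      lower-bound w∈S = from (minL1-≤⇔ h u us) (_ , from (∈-members≡⇔ eq) w∈S , ≤-refl)
      attained : ∃[ w ] w ∈ᵥ S × suc (minL1 (h u) (map h us)) ≡ suc (h w)
      attained with to (minL1-≤⇔ h u us) ≤-refl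
      ... | w , w∈ , hw≤min = w , w∈S , cong suc (≤-antisym (lower-bound w∈S) hw≤min)
        where
        w∈S : w ∈ᵥ S
        w∈S = to (∈-members≡⇔ eq) w∈

  td-components : ∀ S m → td[ S ] ≤ m ⇔ (∀ {x} → x ∈ᵥ S → td[ component G S x ] ≤ m)
  td-components S m rewrite td-unfold S = by-members (members S) refl
    where
    by-members : ∀ l → members S ≡ l →
                 tdF G (suc (n G)) S ≤ m ⇔ (∀ {x} → x ∈ᵥ S → td[ component G S x ] ≤ m)
    by-members [] eq = mk⇔ (λ _ {x} x∈S → contradiction x∈S (members≡[]⇒empty eq))
                           (λ _ → subst (_≤ m) (sym (tdF-empty (suc (n G)) (members≡[]⇒empty eq))) z≤n)
    by-members (u ∷ us) eq with S ⊆ᵥ? component G S u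
    ... | yes S⊆ = mk⇔
      (λ le {x} x∈S → subst (_≤ m) (sym (same x∈S)) le)
      (λ le → subst (_≤ m) (same u∈S) (le u∈S))
      where
      u∈S : u ∈ᵥ S
      u∈S = to (∈-members≡⇔ eq) (here refl)
      same : ∀ {x} → x ∈ᵥ S → td[ component G S x ] ≡ tdF G (suc (n G)) S
      same {x} x∈S = begin
        td[ component G S x ] ≡⟨ td-cong (component-≗ S u (S⊆ x∈S)) ⟩
        td[ component G S u ] ≡⟨ td-cong (⊆ᵥ-antisym (component-⊆ S u) S⊆) ⟩
        td[ S ]               ≡⟨ td-unfold S ⟩
        tdF G (suc (n G)) S   ∎
    ... | no S⊈ rewrite tdF-disconnected (n G) eq S⊈ = mk⇔
      (λ le {x} x∈S → to (maxL-≤⇔ _ (u ∷ us)) le (from (∈-members≡⇔ eq) x∈S))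
      (λ le → from (maxL-≤⇔ _ (u ∷ us)) (λ x∈ → le (to (∈-members≡⇔ eq) (x∈))))

  td≤0⇔empty : ∀ S → td[ S ] ≤ 0 ⇔ (∀ {x} → x ∉ᵥ S)
  td≤0⇔empty S = mk⇔
    (λ td≤0 {x} x∈S → component-nonzero x∈S (to (td-components S 0) td≤0 x∈S))
    (λ empty → subst (_≤ 0) (sym (tdF-empty (n G) empty)) z≤n)
    where
    component-nonzero : ∀ {x} → x ∈ᵥ S → td[ component G S x ] ≤ 0 → ⊥
    component-nonzero {x} x∈S td≤0
      with proj₁ (td-connected (component G S x) (component-self S x x∈S) (component-connected S x))
    ... | _ , _ , td≡suc = <⇒≱ (subst (0 <_) (sym td≡suc) (s≤s z≤n)) td≤0

  td-connected≤suc⇔ : ∀ S {v} → v ∈ᵥ S → Connected S → ∀ m →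
                      td[ S ] ≤ suc m ⇔ (∃[ w ] w ∈ᵥ S × td[ remove S w ] ≤ m)
  td-connected≤suc⇔ S v∈S connected m with td-connected S v∈S connected
  ... | (w , w∈S , td≡suc) , bound = mk⇔
    (λ td≤ → w , w∈S , ≤-pred (subst (_≤ suc m) td≡suc td≤))
    (λ (u , u∈S , td≤m) → ≤-trans (bound u∈S) (s≤s td≤m))

  td≤suc⇔ : ∀ S m → td[ S ] ≤ suc m ⇔
            (∀ {x} → x ∈ᵥ S → ∃[ v ] v ∈ᵥ component G S x × td[ remove (component G S x) v ] ≤ m)
  td≤suc⇔ S m = mk⇔
    (λ td≤ {x} x∈S → to (component≤suc⇔ x∈S) (to (td-components S (suc m)) td≤ x∈S))
    (λ split → from (td-components S (suc m)) (λ {x} x∈S → from (component≤suc⇔ x∈S) (split x∈S)))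
    where
    component≤suc⇔ : ∀ {x} → x ∈ᵥ S → td[ component G S x ] ≤ suc m ⇔
                     (∃[ v ] v ∈ᵥ component G S x × td[ remove (component G S x) v ] ≤ m)
    component≤suc⇔ {x} x∈S =
      td-connected≤suc⇔ (component G S x) (component-self S x x∈S) (component-connected S x) m

distanceBound : ℕ → ℕ
distanceBound zero    = 0
distanceBound (suc j) = suc (distanceBound j) + suc (distanceBound j)

module Distance (G : Graph) where
  open Reachability G
  open TreeDepth G

  td≤⇒component-⊆-reach : ∀ j S {x} → td[ S ] ≤ j → x ∈ᵥ S →
                          component G S x ⊆ᵥ reach S x (distanceBound j)
  td≤⇒component-⊆-reach zero    S td≤0 x∈S = contradiction x∈S (to (td≤0⇔empty S) td≤0)
  td≤⇒component-⊆-reach (suc j) S {x} td≤ x∈S {y} y∈C with to (td≤suc⇔ S j) td≤ x∈S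
  ... | v , v∈C , td-C′≤j = reach-trans S x v (suc B) (suc B) x↝v v↝y
    where
    B  = distanceBound j
    C  = component G S x
    C′ = remove C v
    C′⊆S : C′ ⊆ᵥ S
    C′⊆S = component-⊆ S x ∘ remove-⊆ C v
    v∈S : v ∈ᵥ S
    v∈S = component-⊆ S x v∈C
    within : ∀ {a c} → c ∈ᵥ component G C′ a → c ∈ᵥ reach S a B
    within {a} c∈ = reach-monoˢ a B C′⊆S
      (td≤⇒component-⊆-reach j C′ td-C′≤j (reach-source C′ a (n G) c∈) c∈)
    hop : ∀ {u} → u ∈ᵥ C → u ≡ v ⊎ ∃[ b ] b ∈ᵥ component G C′ u × Edge b v
    hop {u} u∈C with u ≟ v
    ... | yes u≡v = inj₁ u≡v
    ... | no  u≢v = inj₂ (neighbour-of-removed C (component-connected S x) v∈C u∈C u≢v)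
    x↝v : v ∈ᵥ reach S x (suc B)
    x↝v with hop (component-self S x x∈S)
    ... | inj₁ refl              = reach-mono S x {j = suc B} z≤n (reach-self S x x∈S)
    ... | inj₂ (b , b∈ , edge)   = reach-edge S x B (within b∈) v∈S edge
    v↝y : y ∈ᵥ reach S v (suc B)
    v↝y with hop y∈C
    ... | inj₁ refl              = reach-mono S v {j = suc B} z≤n (reach-self S v v∈S)
    ... | inj₂ (b , b∈ , edge)   = reach-trans S v b 1 B
            (reach-edge S v 0 (reach-self S v v∈S) (C′⊆S (component-⊆ C′ y b∈)) (Edge-sym edge))
            (within (component-sym C′ y b∈))

  td≤suc⇔balls : ∀ S j → let L = distanceBound (suc j) in
                 td[ S ] ≤ suc j ⇔
                 (∀ {x} → x ∈ᵥ S →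
                    Saturated S x L × ∃[ v ] v ∈ᵥ reach S x L × td[ remove (reach S x L) v ] ≤ j)
  td≤suc⇔balls S j = mk⇔
    (λ td≤ {x} x∈S →
       ball-is-component x∈S (td≤⇒component-⊆-reach (suc j) S td≤ x∈S) (to (td≤suc⇔ S j) td≤ x∈S))
    (λ balls → from (td≤suc⇔ S j) (λ x∈S → component-is-ball x∈S (balls x∈S)))
    where
    L = distanceBound (suc j)
    ball≗component : ∀ {x} → component G S x ⊆ᵥ reach S x L → reach S x L ≗ component G S x
    ball≗component C⊆ = ⊆ᵥ-antisym (reach-⊆-component S _ L) C⊆
    ball-is-component : ∀ {x} → x ∈ᵥ S → component G S x ⊆ᵥ reach S x L →
      (∃[ v ] v ∈ᵥ component G S x × td[ remove (component G S x) v ] ≤ j) →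
      Saturated S x L × ∃[ v ] v ∈ᵥ reach S x L × td[ remove (reach S x L) v ] ≤ j
    ball-is-component {x} x∈S C⊆ (v , v∈C , td≤j) =
      C⊆ ∘ reach-⊆-component S x (suc L) ,
      v , C⊆ v∈C , subst (_≤ j) (td-cong (remove-cong v (sym ∘ ball≗component C⊆))) td≤j
    component-is-ball : ∀ {x} → x ∈ᵥ S →
      Saturated S x L × (∃[ v ] v ∈ᵥ reach S x L × td[ remove (reach S x L) v ] ≤ j) →
      ∃[ v ] v ∈ᵥ component G S x × td[ remove (component G S x) v ] ≤ j
    component-is-ball {x} x∈S (saturated , v , v∈B , td≤j) =
      v , reach-⊆-component S x L v∈B ,
      subst (_≤ j) (td-cong (remove-cong v (ball≗component (saturated⇒component-⊆ S x {L} saturated)))) td≤j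

-- A formula in one distinguished variable and m parameters (placed by the renaming), uniform in
-- the number k of variables in scope so that it can be used under binders.
Definable : ℕ → Set
Definable m = ∀ {k} → (Fin m → Fin k) → Fin k → Formula k

↑_ : ∀ {m k} → (Fin m → Fin k) → Fin m → Fin (suc k)
(↑ r) i = suc (r i)

reachF : ∀ {m} → Definable m → ℕ → ∀ {k} → (Fin m → Fin k) → Fin k → Fin k → Formula k
reachF D zero    r x z = D r z ∧' (z ≐ x)
reachF D (suc i) r x z =
  reachF D i r x z ∨' (D r z ∧' ∃' (reachF D i (↑ r) (suc x) zero ∧' (D (↑ r) zero ∧' E zero (suc z))))

saturatedF : ∀ {m} → Definable m → ℕ → ∀ {k} → (Fin m → Fin k) → Fin k → Formula k
saturatedF D L r x = ∀' (¬' (reachF D (suc L) (↑ r) (suc x) zero) ∨' reachF D L (↑ r) (suc x) zero)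

-- Parameter 0 is the removed vertex, parameter 1 the centre of the ball.
removeFromBallF : ∀ {m} → Definable m → ℕ → Definable (suc (suc m))
removeFromBallF D L r z = reachF D L (λ i → r (suc (suc i))) (r (suc zero)) z ∧' ¬' (z ≐ r zero)

-- The saturation conjunct certifies that the ball around x is its whole component.
tdAtMostF : ℕ → ∀ {m} → Definable m → ∀ {k} → (Fin m → Fin k) → Formula k
tdAtMostF zero    D r = ∀' (¬' (D (↑ r) zero))
tdAtMostF (suc j) D r = ∀' (¬' (D (↑ r) zero) ∨'
  (saturatedF D L (↑ r) zero ∧'
   ∃' (reachF D L (↑ ↑ r) (suc zero) zero ∧'
       tdAtMostF j (removeFromBallF D L) (extend zero (extend (suc zero) (↑ ↑ r))))))
  where L = distanceBound (suc j)

everywhere : Definable 0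
everywhere _ z = z ≐ z

tdExactlyF : ℕ → Sentence
tdExactlyF zero    = tdAtMostF zero everywhere (λ ())
tdExactlyF (suc k) = tdAtMostF (suc k) everywhere (λ ()) ∧' ¬' (tdAtMostF k everywhere (λ ()))

module Semantics (G : Graph) where
  open Reachability G
  open TreeDepth G
  open Distance G

  Defines : ∀ {m} → Definable m → ((Fin m → V) → VSet (n G)) → Set
  Defines {m} D I = ∀ {k} (r : Fin m → Fin k) z (ρ : Fin k → V) → Sat G (D r z) ρ ⇔ ρ z ∈ᵥ I (ρ ∘ r)

  removeFromBall : ∀ {m} → ((Fin m → V) → VSet (n G)) → ℕ → (Fin (suc (suc m)) → V) → VSet (n G)
  removeFromBall I L ρ = remove (reach (I (λ i → ρ (suc (suc i)))) (ρ (suc zero)) L) (ρ zero)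

  module _ {m} {D : Definable m} {I : (Fin m → V) → VSet (n G)} (D⇔I : Defines D I) where

    sat-reachF : ∀ i {k} (r : Fin m → Fin k) x z ρ →
                 Sat G (reachF D i r x z) ρ ⇔ ρ z ∈ᵥ reach (I (ρ ∘ r)) (ρ x) i
    sat-reachF zero r x z ρ = mk⇔
      (λ (z∈D , z≡x) → from (∈-reach-zero⇔ (I (ρ ∘ r)) (ρ x)) (to (D⇔I r z ρ) z∈D , z≡x))
      (λ z∈R → let z∈S , z≡x = to (∈-reach-zero⇔ (I (ρ ∘ r)) (ρ x)) z∈R in from (D⇔I r z ρ) z∈S , z≡x)
    sat-reachF (suc i) r x z ρ = mk⇔ forward backward
      where
      S = I (ρ ∘ r)
      reach⇔ : ∀ w → Sat G (reachF D i (↑ r) (suc x) zero) (extend w ρ) ⇔ w ∈ᵥ reach S (ρ x) i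
      reach⇔ w = sat-reachF i (↑ r) (suc x) zero (extend w ρ)
      forward : Sat G (reachF D (suc i) r x z) ρ → ρ z ∈ᵥ reach S (ρ x) (suc i)
      forward (inj₁ z∈R) = reach-suc S (ρ x) i (to (sat-reachF i r x z ρ) z∈R)
      forward (inj₂ (z∈D , w , w∈R , w∈D , edge)) =
        reach-edge S (ρ x) i (to (reach⇔ w) w∈R) (to (D⇔I r z ρ) z∈D) (from T-≡ edge)
      backward : ρ z ∈ᵥ reach S (ρ x) (suc i) → Sat G (reachF D (suc i) r x z) ρ
      backward z∈R with to (∈-reachStep⇔ S (reach S (ρ x) i)) z∈R
      ... | inj₁ z∈R′ = inj₁ (from (sat-reachF i r x z ρ) z∈R′)
      ... | inj₂ (z∈S , w , w∈R , w∈S , edge) =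
        inj₂ (from (D⇔I r z ρ) z∈S , w , from (reach⇔ w) w∈R ,
              from (D⇔I (↑ r) zero (extend w ρ)) w∈S , to T-≡ edge)

    sat-saturatedF : ∀ L {k} (r : Fin m → Fin k) x ρ →
                     Sat G (saturatedF D L r x) ρ ⇔ Saturated (I (ρ ∘ r)) (ρ x) L
    sat-saturatedF L r x ρ = mk⇔ forward backward
      where
      S = I (ρ ∘ r)
      ball⇔ : ∀ i u → Sat G (reachF D i (↑ r) (suc x) zero) (extend u ρ) ⇔ u ∈ᵥ reach S (ρ x) i
      ball⇔ i u = sat-reachF i (↑ r) (suc x) zero (extend u ρ)
      forward : Sat G (saturatedF D L r x) ρ → Saturated S (ρ x) L
      forward sat {u} u∈ with sat u
      ... | inj₁ u∉ = contradiction (from (ball⇔ (suc L) u) u∈) u∉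
      ... | inj₂ u∈′ = to (ball⇔ L u) u∈′
      backward : Saturated S (ρ x) L → Sat G (saturatedF D L r x) ρ
      backward saturated u with T? (reach S (ρ x) (suc L) u)
      ... | yes u∈ = inj₂ (from (ball⇔ L u) (saturated u∈))
      ... | no  u∉ = inj₁ (u∉ ∘ to (ball⇔ (suc L) u))

    defines-removeFromBallF : ∀ L → Defines (removeFromBallF D L) (removeFromBall I L)
    defines-removeFromBallF L r z ρ = mk⇔
      (λ (z∈B , z≢v) → from (∈-remove⇔ B (ρ (r zero))) (to ball⇔ z∈B , z≢v))
      (λ z∈ → let z∈B , z≢v = to (∈-remove⇔ B (ρ (r zero))) z∈ in from ball⇔ z∈B , z≢v)
      where
      B = reach (I (λ i → ρ (r (suc (suc i))))) (ρ (r (suc zero))) L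
      ball⇔ : Sat G (reachF D L (λ i → r (suc (suc i))) (r (suc zero)) z) ρ ⇔ ρ z ∈ᵥ B
      ball⇔ = sat-reachF L (λ i → r (suc (suc i))) (r (suc zero)) z ρ

  sat-tdAtMostF : ∀ j {m} (D : Definable m) I → Defines D I → ∀ {k} (r : Fin m → Fin k) ρ →
                  Sat G (tdAtMostF j D r) ρ ⇔ td[ I (ρ ∘ r) ] ≤ j
  sat-tdAtMostF zero D I D⇔I r ρ = mk⇔
    (λ none → from (td≤0⇔empty S) (λ {x} x∈S → none x (from (D⇔I (↑ r) zero (extend x ρ)) x∈S)))
    (λ td≤0 x x∈D → to (td≤0⇔empty S) td≤0 (to (D⇔I (↑ r) zero (extend x ρ)) x∈D))
    where
    S = I (ρ ∘ r)
  sat-tdAtMostF (suc j) {m} D I D⇔I {k} r ρ = mk⇔ forward backward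
    where
    S = I (ρ ∘ r)
    L = distanceBound (suc j)
    ρ′ : V → V → Fin _ → V
    ρ′ x v = extend v (extend x ρ)
    r′ : Fin (suc (suc m)) → Fin (suc (suc k))
    r′ = extend zero (extend (suc zero) (↑ ↑ r))
    removed⇔ : ∀ x v → Sat G (tdAtMostF j (removeFromBallF D L) r′) (ρ′ x v) ⇔
                       td[ remove (reach S x L) v ] ≤ j
    removed⇔ x v = sat-tdAtMostF j (removeFromBallF D L) (removeFromBall I L)
                     (defines-removeFromBallF {D = D} {I = I} D⇔I L) r′ (ρ′ x v)
    member⇔ : ∀ x → Sat G (D (↑ r) zero) (extend x ρ) ⇔ x ∈ᵥ S
    member⇔ x = D⇔I (↑ r) zero (extend x ρ)
    saturated⇔ : ∀ x → Sat G (saturatedF D L (↑ r) zero) (extend x ρ) ⇔ Saturated S x L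
    saturated⇔ x = sat-saturatedF {D = D} {I = I} D⇔I L (↑ r) zero (extend x ρ)
    ball⇔ : ∀ x v → Sat G (reachF D L (↑ ↑ r) (suc zero) zero) (ρ′ x v) ⇔ v ∈ᵥ reach S x L
    ball⇔ x v = sat-reachF {D = D} {I = I} D⇔I L (↑ ↑ r) (suc zero) zero (ρ′ x v)
    forward : Sat G (tdAtMostF (suc j) D r) ρ → td[ S ] ≤ suc j
    forward sat = from (td≤suc⇔balls S j) ball
      where
      ball : ∀ {x} → x ∈ᵥ S → Saturated S x L × ∃[ v ] v ∈ᵥ reach S x L × td[ remove (reach S x L) v ] ≤ j
      ball {x} x∈S with sat x
      ... | inj₁ x∉D = contradiction (from (member⇔ x) x∈S) x∉D
      ... | inj₂ (saturated , v , v∈B , td≤j) =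
        to (saturated⇔ x) saturated , v , to (ball⇔ x v) v∈B , to (removed⇔ x v) td≤j
    backward : td[ S ] ≤ suc j → Sat G (tdAtMostF (suc j) D r) ρ
    backward td≤ x = [ inj₂ ∘ witness , (λ x∉S → inj₁ (x∉S ∘ to (member⇔ x))) ]′ (toSum (T? (S x)))
      where
      witness : x ∈ᵥ S → Sat G (saturatedF D L (↑ r) zero) (extend x ρ) ×
                ∃[ v ] Sat G (reachF D L (↑ ↑ r) (suc zero) zero) (ρ′ x v) ×
                       Sat G (tdAtMostF j (removeFromBallF D L) r′) (ρ′ x v)
      witness x∈S =
        let saturated , v , v∈B , td≤j = to (td≤suc⇔balls S j) td≤ x∈S
        in from (saturated⇔ x) saturated , v , from (ball⇔ x v) v∈B , from (removed⇔ x v) td≤j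

  ⊨tdAtMost⇔ : ∀ j → G ⊨ tdAtMostF j everywhere (λ ()) ⇔ td G ≤ j
  ⊨tdAtMost⇔ j =
    sat-tdAtMostF j everywhere (λ _ _ → true) (λ _ _ _ → mk⇔ (λ _ → _) (λ _ → refl)) (λ ()) (λ ())

  ⊨tdExactly⇔ : ∀ k → G ⊨ tdExactlyF k ⇔ td G ≡ k
  ⊨tdExactly⇔ zero = mk⇔ (n≤0⇒n≡0 ∘ to (⊨tdAtMost⇔ 0)) (from (⊨tdAtMost⇔ 0) ∘ ≤-reflexive)
  ⊨tdExactly⇔ (suc k) = mk⇔
    (λ (⊨≤suc , ⊭≤k) →
       ≤-antisym (to (⊨tdAtMost⇔ (suc k)) ⊨≤suc) (≰⇒> (⊭≤k ∘ from (⊨tdAtMost⇔ k))))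
    (λ td≡ → from (⊨tdAtMost⇔ (suc k)) (≤-reflexive td≡) ,
             λ ⊨≤k → 1+n≰n (subst (_≤ k) td≡ (to (⊨tdAtMost⇔ k) ⊨≤k)))

proposition11 : (k : ℕ) → Σ Sentence (λ φ → (G : Graph) → (td G ≡ k) ⇔ (G ⊨ φ))
proposition11 k = tdExactlyF k , λ G → ⇔-sym (Semantics.⊨tdExactly⇔ G k)
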